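{- Let $\mathcal{A}$ be a $\dagger$-kernel category and let $f:X\to Y$ be a morphism. If $f^\dagger\circ f=0$, then $f=0$.
   Context: A $\dagger$-kernel category is a $\dagger$-category (category with identity-on-objects functor $\dagger:\mathcal{A}^{op}\to\mathcal{A}$, $\dagger\circ\dagger=\mathrm{id}$) with a zero object such that every morphism $f:X\to Y$ has a kernel $k:K\to X$ (an equaliser of $f$ and the zero morphism $0:X\to Y$) satisfying $k^\dagger\circ k=\mathrm{id}_K$. -}

module Defs where

open import Level using (Level; _⊔_; suc)
open import Relation.Binary.PropositionalEquality using (_≡_)
open import Data.Product using (Σ; _×_; _,_; ∃-syntax)

record Category (o ℓ : Level) : Set (suc (o ⊔ ℓ)) where
  infixr 9 _∘_
  field
    Obj   : Set o
    Hom   : Obj → Obj → Set ℓ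
    id    : ∀ {A} → Hom A A
    _∘_   : ∀ {A B C} → Hom B C → Hom A B → Hom A C
    assoc : ∀ {A B C D} (h : Hom C D) (g : Hom B C) (f : Hom A B) →
            (h ∘ g) ∘ f ≡ h ∘ (g ∘ f)
    identityˡ : ∀ {A B} (f : Hom A B) → id ∘ f ≡ f
    identityʳ : ∀ {A B} (f : Hom A B) → f ∘ id ≡ f

module _ {o ℓ : Level} (𝒞 : Category o ℓ) where
  open Category 𝒞

  record IsZeroObject (Z : Obj) : Set (o ⊔ ℓ) where
    field
      ¡      : ∀ {A} → Hom Z A
      ¡-uniq : ∀ {A} (g : Hom Z A) → g ≡ ¡
      !      : ∀ {A} → Hom A Z
      !-uniq : ∀ {A} (g : Hom A Z) → g ≡ !

  record Dagger : Set (o ⊔ ℓ) where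
    field
      _† : ∀ {A B} → Hom A B → Hom B A
      †-identity : ∀ {A} → (id {A}) † ≡ id
      †-homo     : ∀ {A B C} (g : Hom B C) (f : Hom A B) → (g ∘ f) † ≡ (f †) ∘ (g †)
      †-involutive : ∀ {A B} (f : Hom A B) → (f †) † ≡ f

  IsEqualiser : ∀ {K X Y} → Hom K X → Hom X Y → Hom X Y → Set (o ⊔ ℓ)
  IsEqualiser {K} {X} k f g =
    (f ∘ k ≡ g ∘ k) ×
    (∀ {W} (h : Hom W X) → f ∘ h ≡ g ∘ h →
       Σ (Hom W K) λ u → (k ∘ u ≡ h) × (∀ (u' : Hom W K) → k ∘ u' ≡ h → u' ≡ u))

record DaggerKernelCategory (o ℓ : Level) : Set (suc (o ⊔ ℓ)) where
  field
    cat    : Category o ℓ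
  open Category cat
  field
    dagger : Dagger cat
    𝟘      : Obj
    𝟘-isZero : IsZeroObject cat 𝟘
  open Dagger dagger public
  open IsZeroObject 𝟘-isZero public

  zero : ∀ {X Y} → Hom X Y
  zero = ¡ ∘ !

  field
    kernel : ∀ {X Y} (f : Hom X Y) →
      Σ Obj λ K → Σ (Hom K X) λ k →
        IsEqualiser cat k f zero × ((k †) ∘ k ≡ id)

module Submission where

-- Let k : K → X be the kernel of f†
-- (with k† ∘ k = id).  The hypothesis f† ∘ f = 0 = 0 ∘ f says that f
-- equalises f† and 0, so f = k ∘ u for a unique u.  Because k is a dagger
-- mono, u = k† ∘ f, hence u† = f† ∘ k = 0 since k is a kernel of f†.
-- The dagger reflects zero morphisms, so u = 0 and therefore f = k ∘ 0 = 0.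

open import Defs
open import Level using (Level)
open import Relation.Binary.PropositionalEquality
  using (_≡_; sym; trans; cong; cong₂; module ≡-Reasoning)
open import Data.Product using (_,_)

module DaggerKernelFacts {o ℓ : Level} (𝒜 : DaggerKernelCategory o ℓ) where
  open DaggerKernelCategory 𝒜
  open Category cat
  open ≡-Reasoning

  zero-∘ : ∀ {A B C} (g : Hom A B) → zero {B} {C} ∘ g ≡ zero
  zero-∘ g = trans (assoc ¡ ! g) (cong (¡ ∘_) (!-uniq (! ∘ g)))

  ∘-zero : ∀ {A B C} (g : Hom B C) → g ∘ zero {A} {B} ≡ zero
  ∘-zero g = trans (sym (assoc g ¡ !)) (cong (_∘ !) (¡-uniq (g ∘ ¡)))

  -- The dagger of a zero morphism is zero: it factors through the zero object.
  zero-† : ∀ {A B} → zero {A} {B} † ≡ zero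
  zero-† = trans (†-homo ¡ !) (cong₂ _∘_ (¡-uniq (! †)) (!-uniq (¡ †)))

  †-reflects-zero : ∀ {A B} (g : Hom A B) → g † ≡ zero → g ≡ zero
  †-reflects-zero g g†≡0 = begin
    g         ≡⟨ sym (†-involutive g) ⟩
    (g †) †   ≡⟨ cong _† g†≡0 ⟩
    zero †    ≡⟨ zero-† ⟩
    zero      ∎

  dagger-mono-factor : ∀ {A B C} (m : Hom B C) (u : Hom A B) (h : Hom A C) →
    (m †) ∘ m ≡ id → m ∘ u ≡ h → u ≡ (m †) ∘ h
  dagger-mono-factor m u h m†m≡id mu≡h = begin
    u                ≡⟨ sym (identityˡ u) ⟩
    id ∘ u           ≡⟨ cong (_∘ u) (sym m†m≡id) ⟩
    ((m †) ∘ m) ∘ u  ≡⟨ assoc (m †) m u ⟩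
    (m †) ∘ (m ∘ u)  ≡⟨ cong ((m †) ∘_) mu≡h ⟩
    (m †) ∘ h        ∎

  †-of-factor-vanishes : ∀ {K X Y} (f : Hom X Y) (k : Hom K Y) →
    (f †) ∘ k ≡ zero → ((k †) ∘ f) † ≡ zero
  †-of-factor-vanishes f k f†k≡0 = begin
    ((k †) ∘ f) †      ≡⟨ †-homo (k †) f ⟩
    (f †) ∘ ((k †) †)  ≡⟨ cong ((f †) ∘_) (†-involutive k) ⟩
    (f †) ∘ k          ≡⟨ f†k≡0 ⟩
    zero               ∎

  self-adjoint-square-zero : ∀ {X Y} (f : Hom X Y) → (f †) ∘ f ≡ zero → f ≡ zero
  self-adjoint-square-zero f f†f≡0
    with kernel (f †)
  ... | _ , k , ((f†k≡0k , factor) , k†k≡id)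
    with factor f (trans f†f≡0 (sym (zero-∘ f)))
  ... | u , ku≡f , _ = begin
      f         ≡⟨ sym ku≡f ⟩
      k ∘ u     ≡⟨ cong (k ∘_) u≡0 ⟩
      k ∘ zero  ≡⟨ ∘-zero k ⟩
      zero      ∎
    where
      u≡k†f : u ≡ (k †) ∘ f
      u≡k†f = dagger-mono-factor k u f k†k≡id ku≡f

      u≡0 : u ≡ zero
      u≡0 = †-reflects-zero u
        (trans (cong _† u≡k†f)
               (†-of-factor-vanishes f k (trans f†k≡0k (zero-∘ k))))

lemma23 : ∀ {o ℓ : Level} (𝒜 : DaggerKernelCategory o ℓ) →
    let open DaggerKernelCategory 𝒜
        open Category cat
    in ∀ {X Y : Obj} (f : Hom X Y) → (f †) ∘ f ≡ zero → f ≡ zero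
lemma23 𝒜 = DaggerKernelFacts.self-adjoint-square-zero 𝒜
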